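{- Let $n\ge1$ and let $w_0\in S_n$ be the longest permutation, $w_0(i)=n+1-i$. For every $\tau\in S_n$, the sequence $C_{(w_0,\tau)}=((n,\tau(1)),(n-1,\tau(2)),\dots,(1,\tau(n)))$ is the label sequence of a falling maximal chain of $\mathcal{P}_n$.
   Context: Identify a monotone lattice path from $(0,0)$ to $(n-k,k)$ with the $k$-subset of $[n]$ of positions of its North steps. For $k$-subsets $U=\{u_1<\dots<u_k\}$, $L=\{\ell_1<\dots<\ell_k\}$ of $[n]$ with $u_i\le\ell_i$ for all $i$, the lattice path matroid $M[U,L]$ is the matroid on $[n]$ whose bases are the $k$-sets $\{b_1<\dots<b_k\}$ with $u_i\le b_i\le\ell_i$. $\mathcal{P}_n$ is the poset of all lattice path matroids on $[n]$ ordered by the matroid quotient relation ($M'\le_q M$ iff there is a matroid $N$ on $[n]\sqcup T$ with $M=N\setminus T$, $M'=N/T$). Known: $M[U',L']\le_q M[U,L]$ iff $U'\subseteq U$, $L'\subseteq L$ and the greedy pairing is good, where: $(\ell_i,u_j)$ is a good pair of $M[U,L]$ if $i\le j$ and $u_j-\ell_i\le j-i$; with $U\setminus U'=\{a_1<\dots<a_z\}$, $L\setminus L'=\{b_1<\dots<b_z\}$, the greedy pairing $((b_1,a_1),\dots,(b_z,a_z))$ is good if each $(b_r,a_r)$ is a good pair of $M[U\setminus\{a_1,\dots,a_{r-1}\},L\setminus\{b_1,\dots,b_{r-1}\}]$. Covers $M[U\setminus\{u\},L\setminus\{\ell\}]\lessdot M[U,L]$ are labeled $(\ell,u)$. A maximal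 chain $M[\emptyset,\emptyset]=M_0\lessdot\cdots\lessdot M_n=M[[n],[n]]$ has label sequence $((\ell_1,u_1),\dots,(\ell_n,u_n))$ with $(\ell_i,u_i)=\lambda(M_{i-1}\lessdot M_i)$, and is falling if for each $1\le i<n$ it is not the case that both $\ell_i<\ell_{i+1}$ and $u_i<u_{i+1}$. -}

module Defs where

open import Data.Nat using (ℕ; zero; suc; _+_; _∸_; _≤_; _<_; _≟_)
open import Data.Fin using (Fin; toℕ; inject₁; fromℕ) renaming (suc to fsuc; zero to fzero)
open import Data.List using (List; []; _∷_; length; lookup; filter; applyUpTo)
open import Data.List.Relation.Unary.All using (All)
open import Data.List.Relation.Unary.Linked using (Linked)
open import Data.List.Relation.Binary.Pointwise using (Pointwise)
open import Data.List.Membership.DecPropositional _≟_ using (_∈_; _∈?_)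
open import Data.Product using (Σ; _×_; _,_; proj₁; proj₂)
open import Data.Unit using (⊤)
open import Data.Empty using (⊥)
open import Relation.Nullary using (¬_; ¬?)
open import Relation.Binary.PropositionalEquality using (_≡_; _≢_)

-- A k-subset of [n] = {1,…,n} is represented as a strictly increasing list
-- of naturals in the range 1..n (its elements in increasing order).
IsSubsetOf[_] : ℕ → List ℕ → Set
IsSubsetOf[ n ] xs = Linked _<_ xs × All (λ x → 1 ≤ x × x ≤ n) xs

[1‥_] : ℕ → List ℕ
[1‥ n ] = applyUpTo suc n

-- A lattice path matroid M[U,L] on [n]: U = {u_1<…<u_k}, L = {ℓ_1<…<ℓ_k}
-- with u_i ≤ ℓ_i.  (The pair (U,L) is determined by the matroid: U is its
-- lexicographically first basis and L its last one.)
record LPM (n : ℕ) : Set where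
  constructor M[_,_]⟨_,_,_⟩
  field
    U : List ℕ
    L : List ℕ
    U-sub : IsSubsetOf[ n ] U
    L-sub : IsSubsetOf[ n ] L
    U≤L   : Pointwise _≤_ U L
open LPM public

_≈M_ : ∀ {n} → LPM n → LPM n → Set
M ≈M M' = U M ≡ U M' × L M ≡ L M'

remove : ℕ → List ℕ → List ℕ
remove a xs = filter (λ x → ¬? (x ≟ a)) xs

_∖_ : List ℕ → List ℕ → List ℕ
xs ∖ ys = filter (λ x → ¬? (x ∈? ys)) xs

_⊆_ : List ℕ → List ℕ → Set
xs ⊆ ys = All (_∈ ys) xs

GoodPair : List ℕ → List ℕ → ℕ → ℕ → Set
GoodPair Us Ls ℓ u =
  Σ (Fin (length Ls)) λ i → Σ (Fin (length Us)) λ j →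
    toℕ i ≤ toℕ j × lookup Ls i ≡ ℓ × lookup Us j ≡ u × u ≤ ℓ + (toℕ j ∸ toℕ i)

GoodGreedy : List ℕ → List ℕ → List ℕ → List ℕ → Set
GoodGreedy Us Ls []       []       = ⊤
GoodGreedy Us Ls (a ∷ as) (b ∷ bs) =
  GoodPair Us Ls b a × GoodGreedy (remove a Us) (remove b Ls) as bs
GoodGreedy Us Ls _        _        = ⊥

-- matroid quotient order on lattice path matroids (via the known
-- characterization given in the context)
_≤q_ : ∀ {n} → LPM n → LPM n → Set
M' ≤q M = U M' ⊆ U M × L M' ⊆ L M × GoodGreedy (U M) (L M) (U M ∖ U M') (L M ∖ L M')

_<q_ : ∀ {n} → LPM n → LPM n → Set
M' <q M = M' ≤q M × ¬ (M' ≈M M)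

_⋖_ : ∀ {n} → LPM n → LPM n → Set
_⋖_ {n} M' M = M' <q M × ((M'' : LPM n) → M' <q M'' → M'' <q M → ⊥)

HasLabel : ∀ {n} → LPM n → LPM n → ℕ × ℕ → Set
HasLabel M' M (ℓ , u) =
  u ∈ U M × ℓ ∈ L M × U M' ≡ remove u (U M) × L M' ≡ remove ℓ (L M)

-- A maximal chain M[∅,∅] = M_0 ⋖ M_1 ⋖ ⋯ ⋖ M_n = M[[n],[n]] of 𝒫_n
-- (given as c : Fin (n+1) → LPM n) whose label sequence is lab : Fin n → ℕ × ℕ
-- (lab i is the label of the (i+1)-st cover M_i ⋖ M_{i+1}).
IsMaxChainWithLabels : (n : ℕ) → (Fin (suc n) → LPM n) → (Fin n → ℕ × ℕ) → Set
IsMaxChainWithLabels n c lab =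
  (U (c fzero) ≡ [] × L (c fzero) ≡ []) ×
  (U (c (fromℕ n)) ≡ [1‥ n ] × L (c (fromℕ n)) ≡ [1‥ n ]) ×
  ((i : Fin n) → c (inject₁ i) ⋖ c (fsuc i)) ×
  ((i : Fin n) → HasLabel (c (inject₁ i)) (c (fsuc i)) (lab i))

Falling : (n : ℕ) → (Fin n → ℕ × ℕ) → Set
Falling n lab = (i j : Fin n) → toℕ j ≡ suc (toℕ i) →
  ¬ (proj₁ (lab i) < proj₁ (lab j) × proj₂ (lab i) < proj₂ (lab j))

IsFallingChainLabelSeq : (n : ℕ) → (Fin n → ℕ × ℕ) → Set
IsFallingChainLabelSeq n lab =
  Σ (Fin (suc n) → LPM n) (λ c → IsMaxChainWithLabels n c lab) × Falling n lab

{-# OPTIONS --safe #-}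
module Submission where

-- Take M_k = M[U_k, L_k] with U_k = {τ(1), …, τ(k)} and L_k = {n−k+1, …, n}.
-- Since L_k is the interval of the k largest elements of [n], every sorted
-- k-subset of [n] lies entrywise below it, so M_k is a lattice path matroid.
-- Passing from M_{k+1} to M_k removes u = τ(k+1) = u_j from U and the first
-- entry ℓ_1 = n−k from L, and (ℓ_1, u_j) is a good pair because
-- u_j ≤ ℓ_j = ℓ_1 + (j − 1).  Such a one-step quotient is a cover, because
-- |U| strictly increases along the strict quotient order.  The first label
-- coordinates n, n−1, …, 1 decrease, so the chain is falling.

open import Defs
open import Data.Nat using (ℕ; zero; suc; _+_; _∸_; _≤_; _<_; _≟_; _<?_; z≤n; s≤s; s≤s⁻¹; z<s)
open import Data.Nat.Properties
open import Data.Fin using (Fin; toℕ; fromℕ<; inject₁; cast) renaming (zero to fzero; suc to fsuc)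
open import Data.Fin.Properties using (any?; toℕ-injective; toℕ<n; toℕ≤pred[n]; toℕ-fromℕ<; toℕ-fromℕ; toℕ-inject₁; toℕ-cast)
open import Data.Fin.Permutation using (Permutation′; _⟨$⟩ʳ_; _⟨$⟩ˡ_; inverseʳ; inverseˡ)
open import Data.List using (List; []; _∷_; length; lookup; filter; applyUpTo)
open import Data.List.Properties using (filter-all; filter-none; filter-accept; filter-reject)
open import Data.List.Relation.Unary.All as All using (All; []; _∷_)
import Data.List.Relation.Unary.All.Properties as All
open import Data.List.Relation.Unary.Any as Any using (here; there; index)
open import Data.List.Relation.Unary.Any.Properties using (lookup-index)
open import Data.List.Relation.Unary.Linked as Linked using (Linked; []; [-]; _∷_)
import Data.List.Relation.Unary.Linked.Properties as Linked
open import Data.List.Relation.Binary.Pointwise using (Pointwise; []; _∷_; Pointwise-length)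
open import Data.List.Relation.Binary.Pointwise.Properties using (lookup-cast)
open import Data.List.Relation.Binary.Sublist.Propositional using (_∷_; _∷ʳ_; minimum; ⊆-antisym) renaming (_⊆_ to _⊑_)
open import Data.List.Relation.Binary.Sublist.Propositional.Properties using (length-mono-≤; to-≋)
open import Data.List.Relation.Binary.Equality.Propositional using (≋⇒≡)
open import Data.List.Membership.DecPropositional _≟_ using (_∈_; _∈?_)
open import Data.List.Membership.Propositional.Properties using (∈-filter⁺; ∈-filter⁻; ∈-applyUpTo⁺; ∈-applyUpTo⁻)
open import Data.Product using (∃-syntax; _×_; _,_; proj₁; proj₂)
open import Data.Unit using (tt)
open import Data.Empty using (⊥)
open import Function using (_∘_)
open import Relation.Nullary using (¬_; ¬?; Dec)
open import Relation.Nullary.Decidable using (_×-dec_; decidable-stable)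
open import Relation.Binary.PropositionalEquality

Sorted : List ℕ → Set
Sorted = Linked _<_

head<tail : ∀ {x xs} → Sorted (x ∷ xs) → All (x <_) xs
head<tail [-]       = []
head<tail (x<y ∷ s) = x<y ∷ All.map (<-trans x<y) (head<tail s)

⊆-∷⁻ : ∀ {y ys zs} → All (y <_) zs → zs ⊆ (y ∷ ys) → zs ⊆ ys
⊆-∷⁻ y<zs zs⊆ = All.zipWith (λ (y<z , z∈) → Any.tail (>⇒≢ y<z) z∈) (y<zs , zs⊆)

sorted-⊆⇒⊑ : ∀ {xs ys} → Sorted xs → Sorted ys → xs ⊆ ys → xs ⊑ ys
sorted-⊆⇒⊑ {[]}              _  _  _                     = minimum _
sorted-⊆⇒⊑ {x ∷ xs} {y ∷ ys} sx sy (here refl ∷ xs⊆)     =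
  refl ∷ sorted-⊆⇒⊑ (Linked.tail sx) (Linked.tail sy) (⊆-∷⁻ (head<tail sx) xs⊆)
sorted-⊆⇒⊑ {x ∷ xs} {y ∷ ys} sx sy (there x∈ys ∷ xs⊆) =
  y ∷ʳ sorted-⊆⇒⊑ sx (Linked.tail sy)
         (⊆-∷⁻ (y<x ∷ All.map (<-trans y<x) (head<tail sx)) (there x∈ys ∷ xs⊆))
  where
  y<x : y < x
  y<x = All.lookup (head<tail sy) x∈ys

sorted-⊆-antisym : ∀ {xs ys} → Sorted xs → Sorted ys → xs ⊆ ys → ys ⊆ xs → xs ≡ ys
sorted-⊆-antisym sx sy xs⊆ys ys⊆xs = ⊆-antisym (sorted-⊆⇒⊑ sx sy xs⊆ys) (sorted-⊆⇒⊑ sy sx ys⊆xs)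

⊑-length≡⇒≡ : ∀ {xs ys : List ℕ} → xs ⊑ ys → length xs ≡ length ys → xs ≡ ys
⊑-length≡⇒≡ xs⊑ys eq = ≋⇒≡ (to-≋ eq xs⊑ys)

∈-remove⁺ : ∀ {a x xs} → x ∈ xs → x ≢ a → x ∈ remove a xs
∈-remove⁺ {a} = ∈-filter⁺ (λ x → ¬? (x ≟ a))

∈-remove⁻ : ∀ {a x xs} → x ∈ remove a xs → x ∈ xs × x ≢ a
∈-remove⁻ {a} = ∈-filter⁻ (λ x → ¬? (x ≟ a))

remove-⊆ : ∀ {a xs} → remove a xs ⊆ xs
remove-⊆ = All.tabulate (proj₁ ∘ ∈-remove⁻)

remove-sorted : ∀ {a xs} → Sorted xs → Sorted (remove a xs)
remove-sorted {a} = Linked.filter⁺ (λ x → ¬? (x ≟ a)) <-trans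

remove-head : ∀ {a xs} → Sorted (a ∷ xs) → remove a (a ∷ xs) ≡ xs
remove-head {a} {xs} s = begin
  remove a (a ∷ xs) ≡⟨ filter-reject (λ x → ¬? (x ≟ a)) {xs = xs} (λ a≢a → a≢a refl) ⟩
  remove a xs       ≡⟨ filter-all (λ x → ¬? (x ≟ a)) (All.map >⇒≢ (head<tail s)) ⟩
  xs                ∎
  where open ≡-Reasoning

remove-length : ∀ {a xs} → Sorted xs → a ∈ xs → length xs ≡ suc (length (remove a xs))
remove-length s (here refl) = cong (suc ∘ length) (sym (remove-head s))
remove-length {a} {x ∷ xs} s (there a∈xs) = begin
  suc (length xs)                    ≡⟨ cong suc (remove-length (Linked.tail s) a∈xs) ⟩
  suc (suc (length (remove a xs)))   ≡⟨ cong (suc ∘ length) (filter-accept (λ y → ¬? (y ≟ a)) {xs = xs} x≢a) ⟨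
  suc (length (remove a (x ∷ xs)))   ∎
  where
  open ≡-Reasoning
  x≢a : x ≢ a
  x≢a = <⇒≢ (All.lookup (head<tail s) a∈xs)

∖-remove : ∀ {a xs} → Sorted xs → a ∈ xs → xs ∖ remove a xs ≡ a ∷ []
∖-remove {a} {xs} s a∈xs =
  sorted-⊆-antisym (Linked.filter⁺ ∉rest? <-trans s) [-] (All.tabulate only-a) (a-left ∷ [])
  where
  ∉rest? : ∀ x → Dec (¬ x ∈ remove a xs)
  ∉rest? x = ¬? (x ∈? remove a xs)
  only-a : ∀ {x} → x ∈ xs ∖ remove a xs → x ∈ a ∷ []
  only-a x∈ with x∈xs , x∉rest ← ∈-filter⁻ ∉rest? {xs = xs} x∈ =
    here (decidable-stable (_ ≟ a) (x∉rest ∘ ∈-remove⁺ {xs = xs} x∈xs))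
  a-left : a ∈ xs ∖ remove a xs
  a-left = ∈-filter⁺ ∉rest? a∈xs (λ a∈rest → proj₂ (∈-remove⁻ {xs = xs} a∈rest) refl)

rank : ∀ {n} → LPM n → ℕ
rank M = length (U M)

<q⇒rank< : ∀ {n} {M' M : LPM n} → M' <q M → rank M' < rank M
<q⇒rank< {M' = M'} {M} ((U⊆ , L⊆ , _) , M'≉M) =
  ≤∧≢⇒< (length-mono-≤ U⊑) (λ eq → M'≉M (⊑-length≡⇒≡ U⊑ eq , ⊑-length≡⇒≡ L⊑ (L-length eq)))
  where
  U⊑ : U M' ⊑ U M
  U⊑ = sorted-⊆⇒⊑ (proj₁ (U-sub M')) (proj₁ (U-sub M)) U⊆
  L⊑ : L M' ⊑ L M
  L⊑ = sorted-⊆⇒⊑ (proj₁ (L-sub M')) (proj₁ (L-sub M)) L⊆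
  L-length : rank M' ≡ rank M → length (L M') ≡ length (L M)
  L-length eq = begin
    length (L M') ≡⟨ Pointwise-length (U≤L M') ⟨
    rank M'       ≡⟨ eq ⟩
    rank M        ≡⟨ Pointwise-length (U≤L M) ⟩
    length (L M)  ∎
    where open ≡-Reasoning

⋖-intro : ∀ {n} {M' M : LPM n} {ℓ u} → HasLabel M' M (ℓ , u) → GoodPair (U M) (L M) ℓ u → M' ⋖ M
⋖-intro {n} {M'} {M} (u∈U , ℓ∈L , U-eq , L-eq) good = (M'≤M , M'≉M) , no-middle
  where
  rank-suc : rank M ≡ suc (rank M')
  rank-suc = trans (remove-length (proj₁ (U-sub M)) u∈U) (cong (suc ∘ length) (sym U-eq))
  M'≤M : M' ≤q M
  M'≤M rewrite U-eq | L-eq | ∖-remove (proj₁ (U-sub M)) u∈U | ∖-remove (proj₁ (L-sub M)) ℓ∈L =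
    remove-⊆ , remove-⊆ , good , tt
  M'≉M : ¬ (M' ≈M M)
  M'≉M (U-eq' , _) = 1+n≢n (trans (sym rank-suc) (cong length (sym U-eq')))
  no-middle : (M'' : LPM n) → M' <q M'' → M'' <q M → ⊥
  no-middle M'' M'<M'' M''<M = <⇒≱ (<q⇒rank< {M' = M'} {M''} M'<M'') (s≤s⁻¹ M''<1+M')
    where
    M''<1+M' : rank M'' < suc (rank M')
    M''<1+M' = subst (rank M'' <_) rank-suc (<q⇒rank< {M' = M''} {M} M''<M)

interval : ℕ → ℕ → List ℕ
interval c zero    = []
interval c (suc m) = c ∷ interval (suc c) m

interval-sorted : ∀ c m → Sorted (interval c m)
interval-sorted c zero          = []
interval-sorted c (suc zero)    = [-]
interval-sorted c (suc (suc m)) = n<1+n c ∷ interval-sorted (suc c) (suc m)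

∈-interval⁻ : ∀ {x c m} → x ∈ interval c m → c ≤ x × x < c + m
∈-interval⁻ {c = c} {suc m} (here refl) = ≤-refl , m<m+n c z<s
∈-interval⁻ {c = c} {suc m} (there x∈) with c<x , x< ← ∈-interval⁻ x∈ =
  <⇒≤ c<x , <-≤-trans x< (≤-reflexive (sym (+-suc c m)))

applyUpTo-interval : ∀ {f} c → (∀ j → f j ≡ c + j) → ∀ m → applyUpTo f m ≡ interval c m
applyUpTo-interval c f≡ zero    = refl
applyUpTo-interval c f≡ (suc m) =
  cong₂ _∷_ (trans (f≡ 0) (+-identityʳ c))
            (applyUpTo-interval (suc c) (λ j → trans (f≡ (suc j)) (+-suc c j)) m)

lookup-interval : ∀ c m (j : Fin (length (interval c m))) → lookup (interval c m) j ≡ c + toℕ j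
lookup-interval c (suc m) fzero    = sym (+-identityʳ c)
lookup-interval c (suc m) (fsuc j) = trans (lookup-interval (suc c) m j) (sym (+-suc c (toℕ j)))

-- The induction hypothesis bounds the second entry y by c + 1, and x < y.
sorted⇒≤interval : ∀ {xs} c → Sorted xs → All (_< c + length xs) xs →
                   Pointwise _≤_ xs (interval c (length xs))
sorted⇒≤interval c []  []                = []
sorted⇒≤interval c [-] (x<c+1 ∷ [])      = s≤s⁻¹ (<-≤-trans x<c+1 (≤-reflexive (+-comm c 1))) ∷ []
sorted⇒≤interval {_ ∷ ys} c (x<y ∷ s) (_ ∷ bounds)
  with y≤c+1 ∷ rest ← sorted⇒≤interval (suc c) s
                        (All.map (λ b → <-≤-trans b (≤-reflexive (+-suc c (length ys)))) bounds) =
  s≤s⁻¹ (<-≤-trans x<y y≤c+1) ∷ y≤c+1 ∷ rest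

interval-goodPair : ∀ {us u c m} → Pointwise _≤_ us (interval c (suc m)) → u ∈ us →
                    GoodPair us (interval c (suc m)) c u
interval-goodPair {us} {u} {c} {m} us≤ u∈us = fzero , j , z≤n , refl , sym (lookup-index u∈us) , u≤c+j
  where
  j : Fin (length us)
  j = index u∈us
  j' : Fin (length (interval c (suc m)))
  j' = cast (Pointwise-length us≤) j
  u≤c+j : u ≤ c + toℕ j
  u≤c+j = begin
    u                              ≡⟨ lookup-index u∈us ⟩
    lookup us j                    ≤⟨ lookup-cast us≤ (Pointwise-length us≤) j ⟩
    lookup (interval c (suc m)) j' ≡⟨ lookup-interval c (suc m) j' ⟩
    c + toℕ j'                     ≡⟨ cong (c +_) (toℕ-cast _ j) ⟩
    c + toℕ j                      ∎
    where open ≤-Reasoning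

[1‥n]-sorted : ∀ n → Sorted [1‥ n ]
[1‥n]-sorted n = Linked.applyUpTo⁺₂ suc n (λ i → n<1+n (suc i))

[1‥n]-bounded : ∀ n → All (λ x → 1 ≤ x × x ≤ n) [1‥ n ]
[1‥n]-bounded n = All.applyUpTo⁺₁ suc n (λ i<n → s≤s z≤n , i<n)

n∸i-labels-falling : ∀ n (f : Fin n → ℕ) → Falling n (λ i → n ∸ toℕ i , f i)
n∸i-labels-falling n f i j j≡1+i (ℓᵢ<ℓⱼ , _) rewrite j≡1+i = <⇒≱ ℓᵢ<ℓⱼ (∸-monoʳ-≤ n (n≤1+n (toℕ i)))

module Chain (n : ℕ) (τ : Permutation′ n) where

  value : Fin n → ℕ
  value j = suc (toℕ (τ ⟨$⟩ʳ j))

  value-injective : ∀ {i j} → value i ≡ value j → i ≡ j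
  value-injective {i} {j} eq = begin
    i                   ≡⟨ inverseˡ τ ⟨
    τ ⟨$⟩ˡ (τ ⟨$⟩ʳ i)   ≡⟨ cong (τ ⟨$⟩ˡ_) (toℕ-injective (suc-injective eq)) ⟩
    τ ⟨$⟩ˡ (τ ⟨$⟩ʳ j)   ≡⟨ inverseˡ τ ⟩
    j                   ∎
    where open ≡-Reasoning

  Taken : ℕ → ℕ → Set
  Taken k x = ∃[ j ] toℕ j < k × value j ≡ x

  taken? : ∀ k x → Dec (Taken k x)
  taken? k x = any? (λ j → (toℕ j <? k) ×-dec (value j ≟ x))

  Uₖ : ℕ → List ℕ
  Uₖ k = filter (taken? k) [1‥ n ]

  Lₖ : ℕ → List ℕ
  Lₖ k = interval (suc n ∸ k) k

  ∈-Uₖ⁺ : ∀ {k x} → x ∈ [1‥ n ] → Taken k x → x ∈ Uₖ k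
  ∈-Uₖ⁺ {k} = ∈-filter⁺ (taken? k)

  ∈-Uₖ⁻ : ∀ {k x} → x ∈ Uₖ k → x ∈ [1‥ n ] × Taken k x
  ∈-Uₖ⁻ {k} = ∈-filter⁻ (taken? k) {xs = [1‥ n ]}

  Uₖ-sorted : ∀ {k} → Sorted (Uₖ k)
  Uₖ-sorted {k} = Linked.filter⁺ (taken? k) <-trans ([1‥n]-sorted n)

  Uₖ-bounded : ∀ {k} → All (λ x → 1 ≤ x × x ≤ n) (Uₖ k)
  Uₖ-bounded {k} = All.filter⁺ (taken? k) ([1‥n]-bounded n)

  Uₖ-zero : Uₖ 0 ≡ []
  Uₖ-zero = filter-none (taken? 0) {xs = [1‥ n ]} (All.tabulate λ { _ (_ , () , _) })

  Uₖ-full : Uₖ n ≡ [1‥ n ]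
  Uₖ-full = filter-all (taken? n) (All.tabulate every-value-taken)
    where
    every-value-taken : ∀ {x} → x ∈ [1‥ n ] → Taken n x
    every-value-taken x∈ with i , i<n , refl ← ∈-applyUpTo⁻ suc x∈ =
      τ ⟨$⟩ˡ fromℕ< i<n , toℕ<n _ , trans (cong (suc ∘ toℕ) (inverseʳ τ)) (cong suc (toℕ-fromℕ< i<n))

  value∈Uₖ : ∀ {k} j → toℕ j ≡ k → value j ∈ Uₖ (suc k)
  value∈Uₖ j refl = ∈-Uₖ⁺ (∈-applyUpTo⁺ suc (toℕ<n (τ ⟨$⟩ʳ j))) (j , n<1+n (toℕ j) , refl)

  Uₖ-step : ∀ {k} j → toℕ j ≡ k → Uₖ k ≡ remove (value j) (Uₖ (suc k))
  Uₖ-step {k} j refl =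
    sorted-⊆-antisym Uₖ-sorted (remove-sorted Uₖ-sorted) (All.tabulate ⊆-removed) (All.tabulate removed-⊆)
    where
    ⊆-removed : ∀ {x} → x ∈ Uₖ k → x ∈ remove (value j) (Uₖ (suc k))
    ⊆-removed x∈ with x∈[n] , (i , i<k , refl) ← ∈-Uₖ⁻ x∈ =
      ∈-remove⁺ (∈-Uₖ⁺ x∈[n] (i , m<n⇒m<1+n i<k , refl)) (λ eq → <-irrefl (cong toℕ (value-injective eq)) i<k)
    removed-⊆ : ∀ {x} → x ∈ remove (value j) (Uₖ (suc k)) → x ∈ Uₖ k
    removed-⊆ x∈ with x∈U , x≢ ← ∈-remove⁻ x∈ with x∈[n] , (i , i≤k , refl) ← ∈-Uₖ⁻ x∈U =
      ∈-Uₖ⁺ x∈[n] (i , ≤∧≢⇒< (s≤s⁻¹ i≤k) (x≢ ∘ cong value ∘ toℕ-injective) , refl)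

  length-Uₖ : ∀ {k} → k ≤ n → length (Uₖ k) ≡ k
  length-Uₖ {zero}  _   = cong length Uₖ-zero
  length-Uₖ {suc k} k<n = begin
    length (Uₖ (suc k))                           ≡⟨ remove-length Uₖ-sorted (value∈Uₖ j j≡k) ⟩
    suc (length (remove (value j) (Uₖ (suc k))))  ≡⟨ cong (suc ∘ length) (Uₖ-step j j≡k) ⟨
    suc (length (Uₖ k))                           ≡⟨ cong suc (length-Uₖ (<⇒≤ k<n)) ⟩
    suc k                                         ∎
    where
    open ≡-Reasoning
    j : Fin n
    j = fromℕ< k<n
    j≡k : toℕ j ≡ k
    j≡k = toℕ-fromℕ< k<n

  Lₖ-step : ∀ {k} → k < n → Lₖ k ≡ remove (n ∸ k) (Lₖ (suc k))
  Lₖ-step {k} k<n = trans (cong (λ c → interval c k) (+-∸-assoc 1 (<⇒≤ k<n)))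
                          (sym (remove-head (interval-sorted (n ∸ k) (suc k))))

  Lₖ-full : Lₖ n ≡ [1‥ n ]
  Lₖ-full = trans (cong (λ c → interval c n) (m+n∸n≡m 1 n)) (sym (applyUpTo-interval 1 (λ _ → refl) n))

  Lₖ-bounded : ∀ {k} → k ≤ n → All (λ x → 1 ≤ x × x ≤ n) (Lₖ k)
  Lₖ-bounded {k} k≤n = All.tabulate λ x∈ → let c≤x , x< = ∈-interval⁻ x∈ in
    ≤-trans (≤-trans (s≤s z≤n) (≤-reflexive (sym (+-∸-assoc 1 k≤n)))) c≤x ,
    s≤s⁻¹ (<-≤-trans x< (≤-reflexive (m∸n+n≡m (m≤n⇒m≤1+n k≤n))))

  Uₖ≤Lₖ : ∀ {k} → k ≤ n → Pointwise _≤_ (Uₖ k) (Lₖ k)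
  Uₖ≤Lₖ {k} k≤n = subst (λ m → Pointwise _≤_ (Uₖ k) (interval (suc n ∸ k) m)) (length-Uₖ k≤n)
    (sorted⇒≤interval (suc n ∸ k) Uₖ-sorted
      (All.map (λ (_ , x≤n) → <-≤-trans (s≤s x≤n) (≤-reflexive (sym top))) Uₖ-bounded))
    where
    top : suc n ∸ k + length (Uₖ k) ≡ suc n
    top = trans (cong (suc n ∸ k +_) (length-Uₖ k≤n)) (m∸n+n≡m (m≤n⇒m≤1+n k≤n))

  Mₖ : (k : ℕ) → k ≤ n → LPM n
  Mₖ k k≤n =
    M[ Uₖ k , Lₖ k ]⟨ (Uₖ-sorted , Uₖ-bounded) , (interval-sorted (suc n ∸ k) k , Lₖ-bounded k≤n) , Uₖ≤Lₖ k≤n ⟩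

  Mₖ-hasLabel : ∀ {k} i → k ≡ toℕ i → (p : k ≤ n) (q : suc (toℕ i) ≤ n) →
    HasLabel (Mₖ k p) (Mₖ (suc (toℕ i)) q) (n ∸ toℕ i , value i)
  Mₖ-hasLabel i refl _ _ = value∈Uₖ i refl , here refl , Uₖ-step i refl , Lₖ-step (toℕ<n i)

  Mₖ-⋖ : ∀ {k} i → k ≡ toℕ i → (p : k ≤ n) (q : suc (toℕ i) ≤ n) → Mₖ k p ⋖ Mₖ (suc (toℕ i)) q
  Mₖ-⋖ {k} i k≡i p q = ⋖-intro {M' = Mₖ k p} {Mₖ (suc (toℕ i)) q}
    (Mₖ-hasLabel i k≡i p q) (interval-goodPair (Uₖ≤Lₖ q) (value∈Uₖ i refl))

  chain : Fin (suc n) → LPM n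
  chain k = Mₖ (toℕ k) (toℕ≤pred[n] k)

  chain-isMaxChain : IsMaxChainWithLabels n chain (λ i → n ∸ toℕ i , value i)
  chain-isMaxChain =
    (Uₖ-zero , refl) ,
    (trans (cong Uₖ (toℕ-fromℕ n)) Uₖ-full , trans (cong Lₖ (toℕ-fromℕ n)) Lₖ-full) ,
    (λ i → Mₖ-⋖ i (toℕ-inject₁ i) (toℕ≤pred[n] (inject₁ i)) (toℕ≤pred[n] (fsuc i))) ,
    (λ i → Mₖ-hasLabel i (toℕ-inject₁ i) (toℕ≤pred[n] (inject₁ i)) (toℕ≤pred[n] (fsuc i)))

lemma3p13 : (n : ℕ) → 1 ≤ n → (τ : Permutation′ n) →
    IsFallingChainLabelSeq n (λ i → (n ∸ toℕ i , suc (toℕ (τ ⟨$⟩ʳ i))))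
lemma3p13 n _ τ = (chain , chain-isMaxChain) , n∸i-labels-falling n value
  where open Chain n τ
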